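{- Let $k\in\mathbb{Z}_+$. Consider labeled forests $F, G$ such that $P(F)[\alpha_F \,..\, \beta_F) = P(G)[\alpha_G \,..\, \beta_G) = Q^e$ for a balanced string $Q$ of length $0 < |Q| \leq 4k$, an integer exponent $e \geq 6k$, and indices $\alpha_F,\alpha_G,\beta_F,\beta_G$ satisfying $|\alpha_F - \alpha_G| \leq 2k$. Let $F',G'$ be labeled forests such that $P(F') = P(F)[0 \,..\, \alpha_F) \cdot Q^{e'} \cdot P(F)[\beta_F \,..\, |P(F)|)$ and $P(G') = P(G)[0 \,..\, \alpha_G) \cdot Q^{e'} \cdot P(G)[\beta_G \,..\, |P(G)|)$ for some integer exponent $e'\ge 6k$. Then $\mathsf{ted}_{\le k}(F, G) = \mathsf{ted}_{\le k}(F', G')$.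
   Context: A forest is a possibly empty sequence of non-empty rooted ordered trees; a labeled forest assigns each node a label from an integer alphabet $\Sigma$. Parentheses representation: if $F$ consists of trees $T_1,\dots,T_m$ with roots $v_i$ and $F_i$ the forest of descendants of $v_i$, then $P(F)=\bigodot_{i}\big(\texttt{(}_{\lambda(v_i)}P(F_i)\texttt{)}_{\lambda(v_i)}\big)$, a string over $\{\texttt{(},\texttt{)}\}\times\Sigma$. $S[i\,..\,j)=S[i]\cdots S[j-1]$. A string over this alphabet is balanced if it is well-parenthesized and each matched pair carries the same label. $Q^e$ denotes $e$ concatenated copies of $Q$. $\mathsf{ted}(F,G)$ is the minimum number of edits (relabel a node; delete a node, its children taking its place in order; insert a node, the inverse of deletion) transforming $F$ into $G$; $\mathsf{ted}_{\le k}(F,G)=\mathsf{ted}(F,G)$ if at most $k$, else $\infty$. -}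

module Defs where

open import Data.Nat using (ℕ; zero; suc; _+_; _≤_; _<_)
open import Data.Bool using (Bool; true; false)
open import Data.List using (List; []; _∷_; _++_; take; drop; length)
open import Data.Product using (_×_; _,_)
open import Data.Maybe using (Maybe; just; nothing)

Label : Set
Label = ℕ

data Tree : Set where
  node : Label → List Tree → Tree

Forest : Set
Forest = List Tree

-- Parenthesis symbols: (true , a) is "(_a", (false , a) is ")_a".
Paren : Set
Paren = Bool × Label

op cl : Label → Paren
op a = (true , a)
cl a = (false , a)

mutual
  P : Forest → List Paren
  P [] = []
  P (t ∷ ts) = PT t ++ P ts

  PT : Tree → List Paren
  PT (node a cs) = op a ∷ (P cs ++ cl a ∷ [])

slice : {A : Set} → List A → ℕ → ℕ → List A
slice S i j = take (j Data.Nat.∸ i) (drop i S)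

pow : {A : Set} → List A → ℕ → List A
pow Q zero = []
pow Q (suc e) = Q ++ pow Q e

data Balanced : List Paren → Set where
  bal-nil  : Balanced []
  bal-cons : ∀ a s t → Balanced s → Balanced t →
             Balanced (op a ∷ (s ++ (cl a ∷ t)))

data Step : Forest → Forest → Set where
  relabel : ∀ a b cs xs ys →
            Step (xs ++ node a cs ∷ ys) (xs ++ node b cs ∷ ys)
  delete  : ∀ a cs xs ys →
            Step (xs ++ node a cs ∷ ys) (xs ++ (cs ++ ys))
  insert  : ∀ a cs xs ys →
            Step (xs ++ (cs ++ ys)) (xs ++ node a cs ∷ ys)
  deep    : ∀ a cs cs' xs ys → Step cs cs' →
            Step (xs ++ node a cs ∷ ys) (xs ++ node a cs' ∷ ys)

data Steps : ℕ → Forest → Forest → Set where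
  done : ∀ F → Steps zero F F
  step : ∀ {n F G H} → Step F G → Steps n G H → Steps (suc n) F H

IsTed : Forest → Forest → ℕ → Set
IsTed F G d = Steps d F G × (∀ m → Steps m F G → d ≤ m)

-- ted_{≤k}(F,G) = r, where r = just d encodes the finite value d and
-- r = nothing encodes ∞.
TedLe : ℕ → Forest → Forest → Maybe ℕ → Set
TedLe k F G (just d) = IsTed F G d × d ≤ k
TedLe k F G nothing  = ∀ m → Steps m F G → k < m

{-# OPTIONS --safe #-}
-- Forests are handled through their parenthesis strings: P is injective, and forest edits are exactly the string
-- edits that relabel, delete or insert a matched pair around a balanced factor. Consider m ≤ k edits leading from
-- P F to P G. An edit overlaps at most two occurrences of Q in any family of disjoint ones (at most one when Q is a
-- single leaf); every other occurrence survives, shifted by at most two symbols, and the edit still applies after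
-- that occurrence is replaced by any balanced string. Hence among the e ≥ 6k aligned copies in the block Q^e of
-- P F some copy far from the ends of the block survives all m edits and lands inside the block Q^e of P G.
-- Replacing it on both sides by QQ, or by nothing, yields an edit sequence between the strings with e + 1, or
-- e − 1, copies, because an occurrence of Q inside Q^e is preceded by a word commuting with Q. Iterating reaches
-- e′, and the same argument runs backwards, so both pairs admit the same edit sequences of length at most k.
module Submission where

open import Defs
open import Data.Nat using (ℕ; zero; suc; pred; _+_; _*_; _∸_; _≤_; _<_; z≤n; s≤s; s≤s⁻¹; _≤?_; _<?_; ∣_-_∣)
open import Data.Nat.Properties
open import Data.Nat.Tactic.RingSolver using (solve-∀)
open import Data.Bool using (true; false)
open import Data.List using (List; []; _∷_; _++_; [_]; length; map; take; drop)
open import Data.List.Properties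
  using (++-assoc; ++-identityʳ; ++-cancelˡ; ++-conicalˡ; ++-conicalʳ; ∷-injective; ++-monoid;
         length-++; length-++-comm; length-map; length-take; length-drop; take++drop≡id; take-all; drop-drop)
open import Data.List.Relation.Unary.All as All using (All; []; _∷_)
open import Data.List.Relation.Unary.Any as Any using (Any; here; there)
open import Data.List.Relation.Unary.Any.Properties using (map⁻)
open import Data.List.Relation.Unary.AllPairs as AllPairs using (AllPairs; []; _∷_)
import Data.List.Relation.Unary.AllPairs.Properties as AllPairs
open import Data.Maybe using (Maybe; just; nothing)
open import Data.Product using (Σ; _×_; _,_; proj₁; proj₂; ∃-syntax)
open import Data.Sum using (_⊎_; inj₁; inj₂)
open import Data.Empty using (⊥; ⊥-elim)
open import Function using (_∘_)
open import Relation.Nullary using (¬_; yes; no)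
open import Relation.Binary.PropositionalEquality
  using (_≡_; refl; sym; trans; cong; cong₂; subst; subst₂; module ≡-Reasoning)
open import Tactic.MonoidSolver using (solve)

module _ {A : Set} where

  ++-split : (xs ys us vs : List A) → xs ++ ys ≡ us ++ vs →
             (∃[ ws ] us ≡ xs ++ ws × ys ≡ ws ++ vs) ⊎ (∃[ w ] ∃[ ws ] xs ≡ us ++ w ∷ ws × vs ≡ w ∷ ws ++ ys)
  ++-split []       ys us       vs eq = inj₁ (us , refl , eq)
  ++-split (x ∷ xs) ys []       vs eq = inj₂ (x , xs , refl , sym eq)
  ++-split (x ∷ xs) ys (u ∷ us) vs eq with ∷-injective eq
  ... | refl , eq′ with ++-split xs ys us vs eq′
  ... | inj₁ (ws , e₁ , e₂)     = inj₁ (ws , cong (x ∷_) e₁ , e₂)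
  ... | inj₂ (w , ws , e₁ , e₂) = inj₂ (w , ws , cong (x ∷_) e₁ , e₂)

  ++-split-≤ : (xs ys us vs : List A) → xs ++ ys ≡ us ++ vs → length xs ≤ length us →
               ∃[ ws ] us ≡ xs ++ ws × ys ≡ ws ++ vs
  ++-split-≤ xs ys us vs eq le with ++-split xs ys us vs eq
  ... | inj₁ r                 = r
  ... | inj₂ (w , ws , refl , _) = ⊥-elim (m+1+n≰m (length us) (subst (_≤ length us) (length-++ us) le))

  ++-cancel-length : (xs ys us vs : List A) → xs ++ ys ≡ us ++ vs → length xs ≡ length us →
                     xs ≡ us × ys ≡ vs
  ++-cancel-length []       ys []       vs eq _ = refl , eq
  ++-cancel-length (x ∷ xs) ys (u ∷ us) vs eq l with ∷-injective eq
  ... | refl , eq′ with ++-cancel-length xs ys us vs eq′ (suc-injective l)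
  ... | refl , e = refl , e

  length≡0⇒[] : (xs : List A) → length xs ≡ 0 → xs ≡ []
  length≡0⇒[] [] _ = refl

  ++-assoc₃ : (ws xs ys zs : List A) → (ws ++ xs) ++ ys ++ zs ≡ ws ++ (xs ++ ys) ++ zs
  ++-assoc₃ ws xs ys zs = solve (++-monoid A)

  infix-within : (ls qs rs us vs ws : List A) → ls ++ qs ++ rs ≡ us ++ vs ++ ws →
                 length us ≤ length ls → length ls + length qs ≤ length us + length vs →
                 ∃[ v₁ ] ∃[ v₂ ] ls ≡ us ++ v₁ × vs ≡ v₁ ++ qs ++ v₂ × rs ≡ v₂ ++ ws
  infix-within ls qs rs us vs ws eq le₁ le₂ with ++-split-≤ us (vs ++ ws) ls (qs ++ rs) (sym eq) le₁
  ... | v₁ , refl , e with ++-split-≤ (v₁ ++ qs) rs vs ws (trans (++-assoc v₁ qs rs) (sym e)) fits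
    where
    fits : length (v₁ ++ qs) ≤ length vs
    fits = +-cancelˡ-≤ (length us) _ _ (begin
      length us + length (v₁ ++ qs)    ≡⟨ cong (length us +_) (length-++ v₁) ⟩
      length us + (length v₁ + length qs) ≡⟨ sym (+-assoc (length us) _ _) ⟩
      length us + length v₁ + length qs ≡⟨ cong (_+ length qs) (sym (length-++ us)) ⟩
      length (us ++ v₁) + length qs ≤⟨ le₂ ⟩
      length us + length vs ∎)
      where open ≤-Reasoning
  ... | v₂ , refl , e′ = v₁ , v₂ , refl , ++-assoc v₁ qs v₂ , e′

-- Forests as balanced strings

P-++ : ∀ xs ys → P (xs ++ ys) ≡ P xs ++ P ys
P-++ []       ys = refl
P-++ (t ∷ xs) ys = trans (cong (PT t ++_) (P-++ xs ys)) (sym (++-assoc (PT t) (P xs) (P ys)))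

P-∷ : ∀ a cs ts → P (node a cs ∷ ts) ≡ op a ∷ P cs ++ cl a ∷ P ts
P-∷ a cs ts = cong (op a ∷_) (++-assoc (P cs) [ cl a ] (P ts))

P-∷-++ : ∀ a cs ts x → P (node a cs ∷ ts) ++ x ≡ op a ∷ P cs ++ cl a ∷ P ts ++ x
P-∷-++ a cs ts x = trans (cong (_++ x) (P-∷ a cs ts)) (cong (op a ∷_) (++-assoc (P cs) (cl a ∷ P ts) x))

P-balanced : ∀ F → Balanced (P F)
P-balanced []               = bal-nil
P-balanced (node a cs ∷ ts) =
  subst Balanced (sym (P-∷ a cs ts)) (bal-cons a (P cs) (P ts) (P-balanced cs) (P-balanced ts))

balanced⇒P : ∀ {M} → Balanced M → ∃[ F ] P F ≡ M
balanced⇒P bal-nil = [] , refl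
balanced⇒P (bal-cons a s t bs bt) with balanced⇒P bs | balanced⇒P bt
... | cs , refl | ts , refl = node a cs ∷ ts , P-∷ a cs ts

StartsOpen : List Paren → Set
StartsOpen x = ∃[ a ] ∃[ U ] x ≡ op a ∷ U

[]-not-open : ¬ StartsOpen []
[]-not-open (_ , _ , ())

cl-not-open : ∀ {b U} → ¬ StartsOpen (cl b ∷ U)
cl-not-open (_ , _ , ())

P-prefix-unique : ∀ ds cs x y → ¬ StartsOpen x → ¬ StartsOpen y → P ds ++ x ≡ P cs ++ y → ds ≡ cs × x ≡ y
P-prefix-unique [] [] x y _ _ eq = refl , eq
P-prefix-unique [] (node a cs ∷ ts) x y ¬ox _ eq = ⊥-elim (¬ox (a , _ , trans eq (P-∷-++ a cs ts y)))
P-prefix-unique (node a ds ∷ ts) [] x y _ ¬oy eq = ⊥-elim (¬oy (a , _ , trans (sym eq) (P-∷-++ a ds ts x)))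
P-prefix-unique (node a ds ∷ ds′) (node b cs ∷ cs′) x y ¬ox ¬oy eq
  with ∷-injective (trans (sym (P-∷-++ a ds ds′ x)) (trans eq (P-∷-++ b cs cs′ y)))
... | refl , eq₁ with P-prefix-unique ds cs _ _ cl-not-open cl-not-open eq₁
... | refl , eq₂ with P-prefix-unique ds′ cs′ x y ¬ox ¬oy (proj₂ (∷-injective eq₂))
... | refl , refl = refl , refl

P-injective : ∀ {F G} → P F ≡ P G → F ≡ G
P-injective {F} {G} eq =
  proj₁ (P-prefix-unique F G [] [] []-not-open []-not-open (trans (++-identityʳ (P F)) (trans eq (sym (++-identityʳ (P G))))))

P-prefix : ∀ F Fm B → P F ≡ P Fm ++ B → ∃[ R ] F ≡ Fm ++ R × P R ≡ B
P-prefix F [] B eq = F , refl , eq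
P-prefix [] (node c ds ∷ Fs) B eq with trans eq (P-∷-++ c ds Fs B)
... | ()
P-prefix (node b cs ∷ ts) (node c ds ∷ Fs) B eq
  with ∷-injective (trans (sym (P-∷ b cs ts)) (trans eq (P-∷-++ c ds Fs B)))
... | refl , eq₁ with P-prefix-unique cs ds _ _ cl-not-open cl-not-open eq₁
... | refl , eq₂ with P-prefix ts Fs B (proj₂ (∷-injective eq₂))
... | R , refl , eq₃ = R , refl , eq₃

opens closes : List Paren → ℕ
opens []                 = 0
opens ((true  , _) ∷ xs) = suc (opens xs)
opens ((false , _) ∷ xs) = opens xs
closes []                 = 0
closes ((true  , _) ∷ xs) = closes xs
closes ((false , _) ∷ xs) = suc (closes xs)

opens-++ : ∀ xs ys → opens (xs ++ ys) ≡ opens xs + opens ys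
opens-++ []                 ys = refl
opens-++ ((true  , _) ∷ xs) ys = cong suc (opens-++ xs ys)
opens-++ ((false , _) ∷ xs) ys = opens-++ xs ys

closes-++ : ∀ xs ys → closes (xs ++ ys) ≡ closes xs + closes ys
closes-++ []                 ys = refl
closes-++ ((true  , _) ∷ xs) ys = closes-++ xs ys
closes-++ ((false , _) ∷ xs) ys = cong suc (closes-++ xs ys)

closes≡opens : ∀ {M} → Balanced M → closes M ≡ opens M
closes≡opens bal-nil = refl
closes≡opens (bal-cons a s t bs bt) = begin
  closes (s ++ cl a ∷ t)           ≡⟨ closes-++ s (cl a ∷ t) ⟩
  closes s + suc (closes t)        ≡⟨ cong₂ (λ m n → m + suc n) (closes≡opens bs) (closes≡opens bt) ⟩
  opens s + suc (opens t)          ≡⟨ +-suc (opens s) (opens t) ⟩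
  suc (opens s + opens t)          ≡⟨ cong suc (sym (opens-++ s (cl a ∷ t))) ⟩
  suc (opens (s ++ cl a ∷ t))      ∎
  where open ≡-Reasoning

prefix-closes≤opens : ∀ {M} → Balanced M → ∀ u v → M ≡ u ++ v → closes u ≤ opens u
prefix-closes≤opens bal-nil [] v eq = z≤n
prefix-closes≤opens (bal-cons a s t bs bt) [] v eq = z≤n
prefix-closes≤opens (bal-cons a s t bs bt) (x ∷ u) v eq with ∷-injective eq
... | refl , eq′ with ++-split u v s (cl a ∷ t) (sym eq′)
... | inj₁ (w , e , _) = ≤-trans (prefix-closes≤opens bs u w e) (n≤1+n _)
... | inj₂ (_ , ws , refl , e) with ∷-injective e
... | refl , e′ = begin
  closes (s ++ cl a ∷ ws)          ≡⟨ closes-++ s (cl a ∷ ws) ⟩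
  closes s + suc (closes ws)       ≤⟨ +-mono-≤ (≤-reflexive (closes≡opens bs)) (s≤s (prefix-closes≤opens bt ws v e′)) ⟩
  opens s + suc (opens ws)         ≡⟨ +-suc (opens s) (opens ws) ⟩
  suc (opens s + opens ws)         ≡⟨ cong suc (sym (opens-++ s (cl a ∷ ws))) ⟩
  suc (opens (s ++ cl a ∷ ws))     ∎
  where open ≤-Reasoning

-- The suffix W of a balanced string has at least as many closes as opens, whereas the prefix W ++ [ cl b ]
-- of a balanced string has more opens than closes.
no-straddle : ∀ U W b V → Balanced (U ++ W) → Balanced (W ++ cl b ∷ V) → ⊥
no-straddle U W b V bUW bWV = <-irrefl refl (begin-strict
  closes U + closes W          <⟨ +-monoʳ-< (closes U) (≤-trans (≤-reflexive (sym closes-W∷b)) closes-W∷b≤) ⟩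
  closes U + opens W           ≤⟨ +-mono-≤ (prefix-closes≤opens bUW U W refl) ≤-refl ⟩ 
  opens U + opens W            ≡⟨ sym (opens-++ U W) ⟩
  opens (U ++ W)               ≡⟨ sym (closes≡opens bUW) ⟩
  closes (U ++ W)              ≡⟨ closes-++ U W ⟩
  closes U + closes W          ∎)
  where
  open ≤-Reasoning
  closes-W∷b : closes (W ++ [ cl b ]) ≡ suc (closes W)
  closes-W∷b = trans (closes-++ W [ cl b ]) (+-comm (closes W) 1)
  closes-W∷b≤ : closes (W ++ [ cl b ]) ≤ opens W
  closes-W∷b≤ = ≤-trans (prefix-closes≤opens bWV (W ++ [ cl b ]) V (sym (++-assoc W [ cl b ] V)))
                        (≤-reflexive (trans (opens-++ W [ cl b ]) (+-identityʳ (opens W))))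

++-∷-assoc : ∀ {A : Set} (L xs : List A) t ys R → L ++ (xs ++ t ∷ ys) ++ R ≡ (L ++ xs) ++ t ∷ ys ++ R
++-∷-assoc L xs t ys R = trans (cong (L ++_) (++-assoc xs (t ∷ ys) R)) (sym (++-assoc L xs (t ∷ ys ++ R)))

++-++-assoc : ∀ {A : Set} (L xs cs ys R : List A) → L ++ (xs ++ cs ++ ys) ++ R ≡ (L ++ xs) ++ cs ++ ys ++ R
++-++-assoc {A} L xs cs ys R = solve (++-monoid A)

Step-frame : ∀ L R {X Y} → Step X Y → Step (L ++ X ++ R) (L ++ Y ++ R)
Step-frame L R (relabel a b cs xs ys) =
  subst₂ Step (sym (++-∷-assoc L xs _ ys R)) (sym (++-∷-assoc L xs _ ys R)) (relabel a b cs (L ++ xs) (ys ++ R))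
Step-frame L R (delete a cs xs ys) =
  subst₂ Step (sym (++-∷-assoc L xs _ ys R)) (sym (++-++-assoc L xs cs ys R)) (delete a cs (L ++ xs) (ys ++ R))
Step-frame L R (insert a cs xs ys) =
  subst₂ Step (sym (++-++-assoc L xs cs ys R)) (sym (++-∷-assoc L xs _ ys R)) (insert a cs (L ++ xs) (ys ++ R))
Step-frame L R (deep a cs cs′ xs ys s) =
  subst₂ Step (sym (++-∷-assoc L xs _ ys R)) (sym (++-∷-assoc L xs _ ys R)) (deep a cs cs′ (L ++ xs) (ys ++ R) s)

data Context : Set where
  top   : Forest → Forest → Context
  under : Forest → Label → Context → Forest → Context

plug : Context → Forest → Forest
plug (top L R)       X = L ++ X ++ R
plug (under L a C R) X = L ++ node a (plug C X) ∷ R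

Step-plug : ∀ C {X Y} → Step X Y → Step (plug C X) (plug C Y)
Step-plug (top L R)       s = Step-frame L R s
Step-plug (under L a C R) s = deep a _ _ L R (Step-plug C s)

_◃_ : Tree → Context → Context
t ◃ top L R       = top (t ∷ L) R
t ◃ under L a C R = under (t ∷ L) a C R

plug-◃ : ∀ t C X → plug (t ◃ C) X ≡ t ∷ plug C X
plug-◃ t (top L R)       X = refl
plug-◃ t (under L a C R) X = refl

under-context : ∀ b A W ts → (∃[ C ] ∀ X → P (plug C X) ≡ A ++ P X ++ W) →
                ∃[ C ] ∀ X → P (plug C X) ≡ op b ∷ A ++ P X ++ W ++ cl b ∷ P ts
under-context b A W ts (C , h) = under [] b C ts , λ X → begin
  P (node b (plug C X) ∷ ts)             ≡⟨ P-∷ b (plug C X) ts ⟩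
  op b ∷ P (plug C X) ++ cl b ∷ P ts     ≡⟨ cong (λ Z → op b ∷ Z ++ cl b ∷ P ts) (h X) ⟩
  op b ∷ (A ++ P X ++ W) ++ cl b ∷ P ts  ≡⟨ cong (op b ∷_) (solve (++-monoid Paren)) ⟩
  op b ∷ A ++ P X ++ W ++ cl b ∷ P ts    ∎
  where open ≡-Reasoning

sibling-context : ∀ b cs A B → (∃[ C ] ∀ X → P (plug C X) ≡ A ++ P X ++ B) →
                  ∃[ C ] ∀ X → P (plug C X) ≡ op b ∷ (P cs ++ cl b ∷ A) ++ P X ++ B
sibling-context b cs A B (C , h) = node b cs ◃ C , λ X → begin
  P (plug (node b cs ◃ C) X)               ≡⟨ cong P (plug-◃ (node b cs) C X) ⟩
  P (node b cs ∷ plug C X)                 ≡⟨ P-∷ b cs (plug C X) ⟩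
  op b ∷ P cs ++ cl b ∷ P (plug C X)       ≡⟨ cong (λ Z → op b ∷ P cs ++ cl b ∷ Z) (h X) ⟩
  op b ∷ P cs ++ cl b ∷ A ++ P X ++ B      ≡⟨ cong (op b ∷_) (sym (++-assoc (P cs) (cl b ∷ A) (P X ++ B))) ⟩
  op b ∷ (P cs ++ cl b ∷ A) ++ P X ++ B    ∎
  where open ≡-Reasoning

factor-context : ∀ F A Fm B → P F ≡ A ++ P Fm ++ B → ∃[ C ] (∀ X → P (plug C X) ≡ A ++ P X ++ B)
factor-context F [] Fm B eq with P-prefix F Fm B eq
... | R , _ , refl = top [] R , λ X → P-++ X R
factor-context (node b cs ∷ ts) (x ∷ A) Fm B eq with ∷-injective (trans (sym (P-∷ b cs ts)) eq)
... | refl , eq′ with ++-split A (P Fm ++ B) (P cs) (cl b ∷ P ts) (sym eq′)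
... | inj₂ (_ , W , refl , e₂) with ∷-injective e₂
...   | refl , e₃ = sibling-context b cs W B (factor-context ts W Fm B e₃)
factor-context (node b cs ∷ ts) (x ∷ A) Fm B eq | refl , eq′ | inj₁ (W , e₁ , e₂) with ++-split (P Fm) B W (cl b ∷ P ts) e₂
...   | inj₁ (W₂ , refl , refl) = under-context b A W₂ ts (factor-context cs A Fm W₂ e₁)
...   | inj₂ (_ , V , e₃ , e₄) with ∷-injective e₄
...     | refl , _ = ⊥-elim (no-straddle A W b V (subst Balanced e₁ (P-balanced cs)) (subst Balanced e₃ (P-balanced Fm)))

balanced-++ : ∀ {X Y} → Balanced X → Balanced Y → Balanced (X ++ Y)
balanced-++ bX bY with balanced⇒P bX | balanced⇒P bY
... | F , refl | G , refl = subst Balanced (P-++ F G) (P-balanced (F ++ G))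

-- Edits of parenthesis strings

data PairEdit : List Paren → List Paren → List Paren → List Paren → Set where
  relabel : ∀ a b → PairEdit [ op a ] [ cl a ] [ op b ] [ cl b ]
  delete  : ∀ a   → PairEdit [ op a ] [ cl a ] [] []
  insert  : ∀ a   → PairEdit [] [] [ op a ] [ cl a ]

data PStep : List Paren → List Paren → Set where
  edit : ∀ {X Y X′ Y′} → PairEdit X Y X′ Y′ → ∀ A M B → Balanced M →
         PStep (A ++ X ++ M ++ Y ++ B) (A ++ X′ ++ M ++ Y′ ++ B)

infixr 5 _◅_ _◅◅_

data PSteps : ℕ → List Paren → List Paren → Set where
  ε   : ∀ {s} → PSteps 0 s s
  _◅_ : ∀ {n s t u} → PStep s t → PSteps n t u → PSteps (suc n) s u

_◅◅_ : ∀ {m n s t u} → PSteps m s t → PSteps n t u → PSteps (m + n) s u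
ε          ◅◅ sts′ = sts′
(st ◅ sts) ◅◅ sts′ = st ◅ (sts ◅◅ sts′)

edit-frame-assoc : ∀ (L A X M Y B R : List Paren) →
                   L ++ (A ++ X ++ M ++ Y ++ B) ++ R ≡ (L ++ A) ++ X ++ M ++ Y ++ B ++ R
edit-frame-assoc L A X M Y B R = solve (++-monoid Paren)

PStep-frame : ∀ L R {s t} → PStep s t → PStep (L ++ s ++ R) (L ++ t ++ R)
PStep-frame L R (edit {X} {Y} {X′} {Y′} e A M B bM) =
  subst₂ PStep (sym (edit-frame-assoc L A X M Y B R)) (sym (edit-frame-assoc L A X′ M Y′ B R))
         (edit e (L ++ A) M (B ++ R) bM)

P-at : ∀ xs a cs ys → P (xs ++ node a cs ∷ ys) ≡ P xs ++ op a ∷ P cs ++ cl a ∷ P ys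
P-at xs a cs ys = trans (P-++ xs _) (cong (P xs ++_) (P-∷ a cs ys))

P-++³ : ∀ xs cs ys → P (xs ++ cs ++ ys) ≡ P xs ++ P cs ++ P ys
P-++³ xs cs ys = trans (P-++ xs _) (cong (P xs ++_) (P-++ cs ys))

P-step : ∀ {F G} → Step F G → PStep (P F) (P G)
P-step (relabel a b cs xs ys) =
  subst₂ PStep (sym (P-at xs a cs ys)) (sym (P-at xs b cs ys)) (edit (relabel a b) (P xs) (P cs) (P ys) (P-balanced cs))
P-step (delete a cs xs ys) =
  subst₂ PStep (sym (P-at xs a cs ys)) (sym (P-++³ xs cs ys)) (edit (delete a) (P xs) (P cs) (P ys) (P-balanced cs))
P-step (insert a cs xs ys) =
  subst₂ PStep (sym (P-++³ xs cs ys)) (sym (P-at xs a cs ys)) (edit (insert a) (P xs) (P cs) (P ys) (P-balanced cs))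
P-step (deep a cs cs′ xs ys s) =
  subst₂ PStep (trans (++-assoc (P xs) [ op a ] _) (sym (P-at xs a cs ys)))
               (trans (++-assoc (P xs) [ op a ] _) (sym (P-at xs a cs′ ys)))
               (PStep-frame (P xs ++ [ op a ]) (cl a ∷ P ys) (P-step s))

P-steps : ∀ {n F G} → Steps n F G → PSteps n (P F) (P G)
P-steps (done F)    = ε
P-steps (step s ss) = P-step s ◅ P-steps ss

pair-edit-forests : ∀ {X Y X′ Y′} → PairEdit X Y X′ Y′ → ∀ Fm →
  ∃[ Fa ] ∃[ Fb ] P Fa ≡ X ++ P Fm ++ Y × P Fb ≡ X′ ++ P Fm ++ Y′ × Step Fa Fb
pair-edit-forests (relabel a b) Fm =
  [ node a Fm ] , [ node b Fm ] , P-∷ a Fm [] , P-∷ b Fm [] , relabel a b Fm [] []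
pair-edit-forests (delete a) Fm =
  [ node a Fm ] , Fm , P-∷ a Fm [] , sym (++-identityʳ (P Fm)) ,
  subst (Step [ node a Fm ]) (++-identityʳ Fm) (delete a Fm [] [])
pair-edit-forests (insert a) Fm =
  Fm , [ node a Fm ] , sym (++-identityʳ (P Fm)) , P-∷ a Fm [] ,
  subst (λ F → Step F [ node a Fm ]) (++-identityʳ Fm) (insert a Fm [] [])

edit-assoc : ∀ (A X M Y B : List Paren) → A ++ (X ++ M ++ Y) ++ B ≡ A ++ X ++ M ++ Y ++ B
edit-assoc A X M Y B = solve (++-monoid Paren)

step-of-PStep : ∀ {F s t} → P F ≡ s → PStep s t → ∃[ G ] P G ≡ t × Step F G
step-of-PStep {F} eq (edit {X} {Y} {X′} {Y′} e A M B bM) with balanced⇒P bM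
... | Fm , refl with pair-edit-forests e Fm
... | Fa , Fb , eFa , eFb , s = plug C Fb , P-plug-Fb , subst (λ F → Step F (plug C Fb)) (sym F≡plug) (Step-plug C s)
  where
  P-F : P F ≡ A ++ P Fa ++ B
  P-F = trans eq (trans (sym (edit-assoc A X _ Y B)) (cong (λ Z → A ++ Z ++ B) (sym eFa)))
  C : Context
  C = proj₁ (factor-context F A Fa B P-F)
  P-plug : ∀ X → P (plug C X) ≡ A ++ P X ++ B
  P-plug = proj₂ (factor-context F A Fa B P-F)
  F≡plug : F ≡ plug C Fa
  F≡plug = P-injective (trans P-F (sym (P-plug Fa)))
  P-plug-Fb : P (plug C Fb) ≡ A ++ X′ ++ P Fm ++ Y′ ++ B
  P-plug-Fb = trans (P-plug Fb) (trans (cong (λ Z → A ++ Z ++ B) eFb) (edit-assoc A X′ _ Y′ B))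

steps-of-PSteps : ∀ {n F s t} → P F ≡ s → PSteps n s t → ∃[ G ] P G ≡ t × Steps n F G
steps-of-PSteps {F = F} refl ε = F , refl , done F
steps-of-PSteps eq (st ◅ sts) with step-of-PStep eq st
... | G₁ , e₁ , s₁ with steps-of-PSteps e₁ sts
... | G , e , ss = G , e , step s₁ ss

PSteps⇒Steps : ∀ {n F G} → PSteps n (P F) (P G) → Steps n F G
PSteps⇒Steps sts with steps-of-PSteps refl sts
... | G′ , e , ss = subst (Steps _ _) (P-injective e) ss

balanced-replace : ∀ U C V D → Balanced (U ++ C ++ V) → Balanced C → Balanced D → Balanced (U ++ D ++ V)
balanced-replace U C V D bUCV bC bD with balanced⇒P bUCV | balanced⇒P bC | balanced⇒P bD
... | F , eF | Fc , refl | Fd , refl with factor-context F U Fc V eF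
... | Ctx , h = subst Balanced (h Fd) (P-balanced (plug Ctx Fd))

-- Copies of Q along an edit sequence

module Tracking (Q : List Paren) (Q-balanced : Balanced Q) (Q-nonempty : 0 < length Q) where

  ∣Q∣ : ℕ
  ∣Q∣ = length Q

  record Occurrence (s : List Paren) : Set where
    constructor occurrence
    field
      before after : List Paren
      split        : s ≡ before ++ Q ++ after

  open Occurrence

  at : ∀ {s} → Occurrence s → ℕ
  at o = length (before o)

  Transfers : ∀ {s t} → ℕ → Occurrence s → Occurrence t → Set
  Transfers n o o′ = ∀ D → Balanced D → PSteps n (before o ++ D ++ after o) (before o′ ++ D ++ after o′)

  -- An edit replaces x symbols at position a and y symbols at position a + x + μ by x′ and y′ symbols;
  -- an occurrence at i lying left of, between or right of them is found at j afterwards.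
  data Shift (a x μ y x′ y′ : ℕ) : ℕ → ℕ → Set where
    left  : ∀ {i} → i + ∣Q∣ ≤ a → Shift a x μ y x′ y′ i i
    inner : ∀ {i j} d → i ≡ a + x + d → j ≡ a + x′ + d → d + ∣Q∣ ≤ μ → Shift a x μ y x′ y′ i j
    right : ∀ {i j} d → i ≡ a + x + μ + y + d → j ≡ a + x′ + μ + y′ + d → Shift a x μ y x′ y′ i j

  -- The occurrence at i overlaps the w symbols at p, or for w = 0 strictly surrounds the insertion point p.
  Straddles : ℕ → ℕ → ℕ → Set
  Straddles p w i = i < p + w × p < i + ∣Q∣

  module _ {s t : List Paren} where

    Hit₁ Hit₂ Hit : PStep s t → ℕ → Set
    Hit₁ (edit {X} e A M B _)     = Straddles (length A) (length X)
    Hit₂ (edit {X} {Y} e A M B _) = Straddles (length A + length X + length M) (length Y)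
    Hit st i = Hit₁ st i ⊎ Hit₂ st i

    Moves : PStep s t → ℕ → ℕ → Set
    Moves (edit {X} {Y} {X′} {Y′} e A M B _) =
      Shift (length A) (length X) (length M) (length Y) (length X′) (length Y′)

    record Survivor (st : PStep s t) (o : Occurrence s) : Set where
      field
        image    : Occurrence t
        moves    : Moves st (at o) (at image)
        transfer : Transfers 1 o image

  private
    one : ∀ {s t} → PStep s t → PSteps 1 s t
    one st = st ◅ ε

    assoc-left : ∀ (L D V Z : List Paren) → (L ++ D ++ V) ++ Z ≡ L ++ D ++ V ++ Z
    assoc-left L D V Z = solve (++-monoid Paren)

    assoc-inner : ∀ (A X m₁ D m₂ Y B : List Paren) → A ++ X ++ (m₁ ++ D ++ m₂) ++ Y ++ B ≡ ((A ++ X) ++ m₁) ++ D ++ m₂ ++ Y ++ B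
    assoc-inner A X m₁ D m₂ Y B = solve (++-monoid Paren)

    assoc-right : ∀ (A X M Y w D R : List Paren) → A ++ X ++ M ++ Y ++ w ++ D ++ R ≡ ((A ++ X ++ M ++ Y) ++ w) ++ D ++ R
    assoc-right A X M Y w D R = solve (++-monoid Paren)

    assoc-block : ∀ (A X M Y B : List Paren) → (A ++ X ++ M ++ Y) ++ B ≡ A ++ X ++ M ++ Y ++ B
    assoc-block A X M Y B = solve (++-monoid Paren)

    length-++₄ : ∀ (A X M Y : List Paren) → length (A ++ X ++ M ++ Y) ≡ length A + length X + length M + length Y
    length-++₄ A X M Y = begin
      length (A ++ X ++ M ++ Y)                         ≡⟨ length-++ A ⟩
      length A + length (X ++ M ++ Y)                   ≡⟨ cong (length A +_) (length-++ X) ⟩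
      length A + (length X + length (M ++ Y))           ≡⟨ cong (λ n → length A + (length X + n)) (length-++ M) ⟩
      length A + (length X + (length M + length Y))     ≡⟨ sym (+-assoc (length A) _ _) ⟩
      length A + length X + (length M + length Y)       ≡⟨ sym (+-assoc (length A + length X) _ _) ⟩
      length A + length X + length M + length Y         ∎
      where open ≡-Reasoning

    length-++₂ : ∀ (A X m : List Paren) → length ((A ++ X) ++ m) ≡ length A + length X + length m
    length-++₂ A X m = trans (length-++ (A ++ X)) (cong (_+ length m) (length-++ A))

  module _ {X Y X′ Y′} (e : PairEdit X Y X′ Y′) (A M B : List Paren) (bM : Balanced M)
           (L R : List Paren) (eq : A ++ X ++ M ++ Y ++ B ≡ L ++ Q ++ R) where

    survive-left : length L + ∣Q∣ ≤ length A → Survivor (edit e A M B bM) (occurrence L R eq)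
    survive-left h with infix-within L Q R [] A (X ++ M ++ Y ++ B) (sym eq) z≤n h
    ... | .L , V , refl , refl , refl = record
      { image    = occurrence L (V ++ X′ ++ M ++ Y′ ++ B) (assoc-left L Q V _)
      ; moves    = left h
      ; transfer = λ D bD → one (subst₂ PStep (assoc-left L D V _) (assoc-left L D V _) (edit e (L ++ D ++ V) M B bM))
      }

    survive-inner : length A + length X ≤ length L → length L + ∣Q∣ ≤ length A + length X + length M →
                    Survivor (edit e A M B bM) (occurrence L R eq)
    survive-inner h₁ h₂
      with infix-within L Q R (A ++ X) M (Y ++ B) (trans (sym eq) (sym (++-assoc A X _)))
             (subst (_≤ length L) (sym (length-++ A)) h₁) (subst (length L + ∣Q∣ ≤_) (cong (_+ length M) (sym (length-++ A))) h₂)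
    ... | m₁ , m₂ , refl , refl , refl = record
      { image    = occurrence ((A ++ X′) ++ m₁) (m₂ ++ Y′ ++ B) (assoc-inner A X′ m₁ Q m₂ Y′ B)
      ; moves    = inner (length m₁) (length-++₂ A X m₁) (length-++₂ A X′ m₁)
                         (≤-trans (+-monoʳ-≤ (length m₁) (m≤m+n ∣Q∣ (length m₂)))
                                  (≤-reflexive (sym (trans (length-++ m₁) (cong (length m₁ +_) (length-++ Q))))))
      ; transfer = λ D bD → one (subst₂ PStep (assoc-inner A X m₁ D m₂ Y B) (assoc-inner A X′ m₁ D m₂ Y′ B)
                                   (edit e A (m₁ ++ D ++ m₂) B (balanced-replace m₁ Q m₂ D bM Q-balanced bD)))
      }

    survive-right : length A + length X + length M + length Y ≤ length L → Survivor (edit e A M B bM) (occurrence L R eq)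
    survive-right h
      with ++-split-≤ (A ++ X ++ M ++ Y) B L (Q ++ R) (trans (assoc-block A X M Y B) eq) (subst (_≤ length L) (sym (length-++₄ A X M Y)) h)
    ... | w , refl , refl = record
      { image    = occurrence ((A ++ X′ ++ M ++ Y′) ++ w) R (assoc-right A X′ M Y′ w Q R)
      ; moves    = right (length w) (trans (length-++ (A ++ X ++ M ++ Y)) (cong (_+ length w) (length-++₄ A X M Y)))
                                    (trans (length-++ (A ++ X′ ++ M ++ Y′)) (cong (_+ length w) (length-++₄ A X′ M Y′)))
      ; transfer = λ D bD → one (subst₂ PStep (assoc-right A X M Y w D R) (assoc-right A X′ M Y′ w D R)
                                   (edit e A M (w ++ D ++ R) bM))
      }

  track : ∀ {s t} (st : PStep s t) (o : Occurrence s) → Hit st (at o) ⊎ Survivor st o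
  track (edit {X} {Y} e A M B bM) (occurrence L R eq) with length L + ∣Q∣ ≤? length A
  ... | yes inA = inj₂ (survive-left e A M B bM L R eq inA)
  ... | no ¬inA with length L <? length A + length X
  ...   | yes h₁ = inj₁ (inj₁ (h₁ , ≰⇒> ¬inA))
  ...   | no ¬h₁ with length L + ∣Q∣ ≤? length A + length X + length M
  ...     | yes inM = inj₂ (survive-inner e A M B bM L R eq (≮⇒≥ ¬h₁) inM)
  ...     | no ¬inM with length L <? length A + length X + length M + length Y
  ...       | yes h₂ = inj₁ (inj₂ (h₂ , ≰⇒> ¬inM))
  ...       | no ¬h₂ = inj₂ (survive-right e A M B bM L R eq (≮⇒≥ ¬h₂))

  private
    no-backtrack : ∀ {i j k} → i + ∣Q∣ ≤ j → j + ∣Q∣ ≤ k → k ≤ i → ⊥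
    no-backtrack {i} {j} {k} h₁ h₂ h₃ = <-irrefl refl (begin-strict
      i                ≤⟨ m≤m+n i ∣Q∣ ⟩
      i + ∣Q∣          ≤⟨ h₁ ⟩
      j                <⟨ m<m+n j Q-nonempty ⟩
      j + ∣Q∣          ≤⟨ h₂ ⟩
      k                ≤⟨ h₃ ⟩
      i                ∎)
      where open ≤-Reasoning

    gap-invariant : ∀ u v d₁ d₂ → u + d₁ + ∣Q∣ ≤ u + d₂ → v + d₁ + ∣Q∣ ≤ v + d₂
    gap-invariant u v d₁ d₂ h = subst (_≤ v + d₂) (sym (+-assoc v d₁ ∣Q∣))
      (+-monoʳ-≤ v (+-cancelˡ-≤ u _ _ (subst (_≤ u + d₂) (+-assoc u d₁ ∣Q∣) h)))

    ≤-+⁴ : ∀ a b c d e → a ≤ a + b + c + d + e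
    ≤-+⁴ a b c d e = ≤-trans (m≤m+n a b) (≤-trans (m≤m+n _ c) (≤-trans (m≤m+n _ d) (m≤m+n _ e)))

    inner-end : ∀ u {d μ} → d + ∣Q∣ ≤ μ → u + d + ∣Q∣ ≤ u + μ
    inner-end u {d} {μ} h = subst (_≤ u + μ) (sym (+-assoc u d ∣Q∣)) (+-monoʳ-≤ u h)

  Shift-spaced : ∀ {a x μ y x′ y′ i i′ j j′} → Shift a x μ y x′ y′ i i′ → Shift a x μ y x′ y′ j j′ →
                 i + ∣Q∣ ≤ j → i′ + ∣Q∣ ≤ j′
  Shift-spaced (left _) (left _) h = h
  Shift-spaced {a} (left h₁) (inner _ refl refl _) _ = ≤-trans h₁ (≤-trans (m≤m+n a _) (m≤m+n _ _))
  Shift-spaced {a} {x′ = x′} (left h₁) (right d refl refl) _ = ≤-trans h₁ (≤-+⁴ a x′ _ _ d)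
  Shift-spaced {a} {x} (inner d refl refl _) (left h₂) h = ⊥-elim (no-backtrack h h₂ (≤-trans (m≤m+n a x) (m≤m+n _ d)))
  Shift-spaced {a} {x} {x′ = x′} (inner d₁ refl refl _) (inner d₂ refl refl _) h = gap-invariant (a + x) (a + x′) d₁ d₂ h
  Shift-spaced {a} {x′ = x′} {y′} (inner d₁ refl refl h₁) (right d₂ refl refl) _ =
    ≤-trans (inner-end (a + x′) h₁) (≤-trans (m≤m+n _ y′) (m≤m+n _ d₂))
  Shift-spaced {a} {x} (right d refl refl) (left h₂) h = ⊥-elim (no-backtrack h h₂ (≤-+⁴ a x _ _ d))
  Shift-spaced {a} {x} {μ} {y} (right d₁ refl refl) (inner d₂ refl refl h₂) h =
    ⊥-elim (no-backtrack h (inner-end (a + x) h₂) (≤-trans (m≤m+n (a + x + μ) y) (m≤m+n _ d₁)))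
  Shift-spaced {a} {x} {μ} {y} {x′} {y′} (right d₁ refl refl) (right d₂ refl refl) h =
    gap-invariant (a + x + μ + y) (a + x′ + μ + y′) d₁ d₂ h

  private
    drift-step : ∀ u p q d → p ≤ q + 2 → u + p + d ≤ u + q + d + 2
    drift-step u p q d h = ≤-trans (+-monoˡ-≤ d (+-monoʳ-≤ u h)) (≤-reflexive (rearrange u q d))
      where
      rearrange : ∀ u q d → u + (q + 2) + d ≡ u + q + d + 2
      rearrange = solve-∀

    outer-widths : ∀ u x μ y d → u + x + μ + y + d ≡ u + μ + (x + y) + d
    outer-widths = solve-∀

    ≤-+2 : ∀ {p} q → p ≤ 2 → p ≤ q + 2
    ≤-+2 q h = ≤-trans h (m≤n+m 2 q)

  Shift-drift : ∀ {a x μ y x′ y′ i j} → x ≤ 1 → y ≤ 1 → x′ ≤ 1 → y′ ≤ 1 →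
                Shift a x μ y x′ y′ i j → j ≤ i + 2 × i ≤ j + 2
  Shift-drift _ _ _ _ (left _) = m≤m+n _ 2 , m≤m+n _ 2
  Shift-drift {a} {x} {x′ = x′} hx _ hx′ _ (inner d refl refl _) =
    drift-step a x′ x d (≤-+2 x (≤-trans hx′ (n≤1+n 1))) , drift-step a x x′ d (≤-+2 x′ (≤-trans hx (n≤1+n 1)))
  Shift-drift {a} {x} {μ} {y} {x′} {y′} hx hy hx′ hy′ (right d refl refl) =
    subst₂ (λ m n → m ≤ n + 2) (sym (outer-widths a x′ μ y′ d)) (sym (outer-widths a x μ y d))
           (drift-step (a + μ) (x′ + y′) (x + y) d (≤-+2 (x + y) (+-mono-≤ hx′ hy′))) ,
    subst₂ (λ m n → m ≤ n + 2) (sym (outer-widths a x μ y d)) (sym (outer-widths a x′ μ y′ d))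
           (drift-step (a + μ) (x + y) (x′ + y′) d (≤-+2 (x′ + y′) (+-mono-≤ hx hy)))

  PairEdit-widths : ∀ {X Y X′ Y′} → PairEdit X Y X′ Y′ →
                    length X ≤ 1 × length Y ≤ 1 × length X′ ≤ 1 × length Y′ ≤ 1
  PairEdit-widths (relabel a b) = ≤-refl , ≤-refl , ≤-refl , ≤-refl
  PairEdit-widths (delete a)    = ≤-refl , ≤-refl , z≤n , z≤n
  PairEdit-widths (insert a)    = z≤n , z≤n , ≤-refl , ≤-refl

  straddle-unique : ∀ {p w i j} → w ≤ 1 → i + ∣Q∣ ≤ j → Straddles p w i → Straddles p w j → ⊥
  straddle-unique {p} {w} {i} {j} hw h (_ , p<i+∣Q∣) (j<p+w , _) =
    <-irrefl refl (<-≤-trans (<-≤-trans p<i+∣Q∣ h) j≤p)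
    where
    j≤p : j ≤ p
    j≤p = s≤s⁻¹ (≤-trans j<p+w (≤-trans (+-monoʳ-≤ p hw) (≤-reflexive (+-comm p 1))))

  Moves-spaced : ∀ {s t} (st : PStep s t) {i i′ j j′} → Moves st i i′ → Moves st j j′ → i + ∣Q∣ ≤ j → i′ + ∣Q∣ ≤ j′
  Moves-spaced (edit e A M B _) = Shift-spaced

  Moves-drift : ∀ {s t} (st : PStep s t) {i j} → Moves st i j → j ≤ i + 2 × i ≤ j + 2
  Moves-drift (edit e A M B _) with PairEdit-widths e
  ... | hx , hy , hx′ , hy′ = Shift-drift hx hy hx′ hy′

  Hit₁-unique : ∀ {s t} (st : PStep s t) {i j} → i + ∣Q∣ ≤ j → Hit₁ st i → ¬ Hit₁ st j
  Hit₁-unique (edit e A M B _) = straddle-unique (proj₁ (PairEdit-widths e))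

  Hit₂-unique : ∀ {s t} (st : PStep s t) {i j} → i + ∣Q∣ ≤ j → Hit₂ st i → ¬ Hit₂ st j
  Hit₂-unique (edit e A M B _) = straddle-unique (proj₁ (proj₂ (PairEdit-widths e)))

  Hit₂-of : ∀ {s t} (st : PStep s t) {i} → ¬ Hit₁ st i → Hit st i → Hit₂ st i
  Hit₂-of st ¬h₁ (inj₁ h₁) = ⊥-elim (¬h₁ h₁)
  Hit₂-of st ¬h₁ (inj₂ h₂) = h₂

  Hit₁-of : ∀ {s t} (st : PStep s t) {i} → ¬ Hit₂ st i → Hit st i → Hit₁ st i
  Hit₁-of st ¬h₂ (inj₁ h₁) = h₁
  Hit₁-of st ¬h₂ (inj₂ h₂) = ⊥-elim (¬h₂ h₂)

  Spaced : ∀ {s} → List (Occurrence s) → Set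
  Spaced = AllPairs (λ o o′ → at o + ∣Q∣ ≤ at o′)

  module _ {s t : List Paren} (st : PStep s t) where

    survivors : List (Occurrence s) → List (Σ (Occurrence s) (Survivor st))
    survivors []       = []
    survivors (o ∷ os) with track st o
    ... | inj₁ _  = survivors os
    ... | inj₂ sv = (o , sv) ∷ survivors os

    survivors⁻ : ∀ {R : Σ (Occurrence s) (Survivor st) → Set} {os} →
                 Any R (survivors os) → Any (λ o → Σ (Survivor st o) (λ sv → R (o , sv))) os
    survivors⁻ {os = o ∷ os} r with track st o
    ... | inj₁ _ = there (survivors⁻ r)
    ... | inj₂ sv with r
    ...   | here  r′ = here (sv , r′)
    ...   | there r′ = there (survivors⁻ r′)

    survivors-All : ∀ {R : Occurrence s → Set} {R′ : Σ (Occurrence s) (Survivor st) → Set} →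
                    (∀ {o} (sv : Survivor st o) → R o → R′ (o , sv)) → ∀ {os} → All R os → All R′ (survivors os)
    survivors-All f {[]}     []       = []
    survivors-All f {o ∷ os} (r ∷ rs) with track st o
    ... | inj₁ _  = survivors-All f rs
    ... | inj₂ sv = f sv r ∷ survivors-All f rs

    survivors-spaced : ∀ {os} → Spaced os →
      AllPairs (λ p q → at (Survivor.image (proj₂ p)) + ∣Q∣ ≤ at (Survivor.image (proj₂ q))) (survivors os)
    survivors-spaced {[]}     []       = []
    survivors-spaced {o ∷ os} (h ∷ hs) with track st o
    ... | inj₁ _  = survivors-spaced hs
    ... | inj₂ sv = survivors-All (λ sv′ → Moves-spaced st (Survivor.moves sv) (Survivor.moves sv′)) h
                    ∷ survivors-spaced hs

    survivors-length₀ : ∀ {os} → All (λ o → ¬ Hit st (at o)) os → length os ≤ length (survivors os)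
    survivors-length₀ {[]}     []         = z≤n
    survivors-length₀ {o ∷ os} (¬h ∷ ¬hs) with track st o
    ... | inj₁ h  = ⊥-elim (¬h h)
    ... | inj₂ sv = s≤s (survivors-length₀ ¬hs)

    survivors-length₁ : (H : ℕ → Set) → ∀ {os} → All (λ o → Hit st (at o) → H (at o)) os →
                        AllPairs (λ o o′ → H (at o) → ¬ H (at o′)) os → length os ≤ 1 + length (survivors os)
    survivors-length₁ H {[]}     []       []       = z≤n
    survivors-length₁ H {o ∷ os} (f ∷ fs) (u ∷ us) with track st o
    ... | inj₁ h  = s≤s (survivors-length₀ (All.zipWith (λ (¬H , g) h′ → ¬H (g h′)) (All.map (λ v → v (f h)) u , fs)))
    ... | inj₂ sv = s≤s (survivors-length₁ H fs us)

    survivors-length₂ : ∀ {os} → AllPairs (λ o o′ → Hit₁ st (at o) → ¬ Hit₁ st (at o′)) os →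
                        AllPairs (λ o o′ → Hit₂ st (at o) → ¬ Hit₂ st (at o′)) os → length os ≤ 2 + length (survivors os)
    survivors-length₂ {[]}     []         []         = z≤n
    survivors-length₂ {o ∷ os} (u₁ ∷ us₁) (u₂ ∷ us₂) with track st o
    ... | inj₁ (inj₁ h₁) =
      s≤s (survivors-length₁ (Hit₂ st) (All.map (λ ¬h₁ → Hit₂-of st ¬h₁) (All.map (λ v → v h₁) u₁)) us₂)
    ... | inj₁ (inj₂ h₂) =
      s≤s (survivors-length₁ (Hit₁ st) (All.map (λ ¬h₂ → Hit₁-of st ¬h₂) (All.map (λ v → v h₂) u₂)) us₁)
    ... | inj₂ sv = s≤s (survivors-length₂ us₁ us₂)

  LossBound : ℕ → Set
  LossBound b = ∀ {s t} (st : PStep s t) (os : List (Occurrence s)) → Spaced os → length os ≤ b + length (survivors st os)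

  loss≤2 : LossBound 2
  loss≤2 st os sp = survivors-length₂ st (AllPairs.map (Hit₁-unique st) sp) (AllPairs.map (Hit₂-unique st) sp)

  record Tracked {s} (n : ℕ) (t : List Paren) (o : Occurrence s) : Set where
    field
      image    : Occurrence t
      drift-≤  : at image ≤ at o + 2 * n
      drift-≥  : at o ≤ at image + 2 * n
      transfer : Transfers n o image

  private
    drift-++ : ∀ {u v w} n → v ≤ u + 2 → w ≤ v + 2 * n → w ≤ u + 2 * suc n
    drift-++ {u} {v} {w} n h₁ h₂ = ≤-trans h₂ (≤-trans (+-monoˡ-≤ (2 * n) h₁) (≤-reflexive (rearrange u n)))
      where
      rearrange : ∀ u n → u + 2 + 2 * n ≡ u + 2 * suc n
      rearrange = solve-∀

    drift-++′ : ∀ {u v w} n → w ≤ v + 2 → v ≤ u + 2 * n → w ≤ u + 2 * suc n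
    drift-++′ {u} {v} {w} n h₁ h₂ = ≤-trans h₁ (≤-trans (+-monoˡ-≤ 2 h₂) (≤-reflexive (rearrange u n)))
      where
      rearrange : ∀ u n → u + 2 * n + 2 ≡ u + 2 * suc n
      rearrange = solve-∀

  tracked : ∀ {b n s t} → LossBound b → PSteps n s t → (os : List (Occurrence s)) → Spaced os →
            b * n < length os → Any (Tracked n t) os
  tracked lb ε (o ∷ os) _ _ = here (record { image = o ; drift-≤ = m≤m+n _ 0 ; drift-≥ = m≤m+n _ 0 ; transfer = λ _ _ → ε })
  tracked {b} {suc n} lb (st ◅ sts) os sp len = Any.map extend (survivors⁻ st (map⁻ rest))
    where
    next : List (Occurrence _)
    next = map (Survivor.image ∘ proj₂) (survivors st os)
    rest : Any (Tracked n _) next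
    rest = tracked lb sts next (AllPairs.map⁺ (survivors-spaced st sp)) fewer
      where
      fewer : b * n < length next
      fewer = subst (b * n <_) (sym (length-map _ (survivors st os)))
        (+-cancelˡ-< b _ _ (<-≤-trans (subst (_< length os) (*-suc b n) len) (lb st os sp)))
    extend : ∀ {o} → Σ (Survivor st o) (λ sv → Tracked n _ (Survivor.image sv)) → Tracked (suc n) _ o
    extend (sv , tr) = record
      { image    = Tracked.image tr
      ; drift-≤  = drift-++ n (proj₁ (Moves-drift st (Survivor.moves sv))) (Tracked.drift-≤ tr)
      ; drift-≥  = drift-++′ n (proj₂ (Moves-drift st (Survivor.moves sv))) (Tracked.drift-≥ tr)
      ; transfer = λ D bD → Survivor.transfer sv D bD ◅◅ Tracked.transfer tr D bD
      }

-- Leaves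

leaf : Label → List Paren
leaf a = op a ∷ cl a ∷ []

drop-length-++ : ∀ {A : Set} (xs ys : List A) → drop (length xs) (xs ++ ys) ≡ ys
drop-length-++ []       ys = refl
drop-length-++ (x ∷ xs) ys = drop-length-++ xs ys

drop-at : ∀ (s U V : List Paren) → s ≡ U ++ V → drop (length U) s ≡ V
drop-at s U V refl = drop-length-++ U V

drop-next : ∀ (s : List Paren) i {x V} → drop i s ≡ x ∷ V → drop (i + 1) s ≡ V
drop-next s i eq = trans (sym (drop-drop i 1 s)) (cong (drop 1) eq)

drop-cong : ∀ {s : List Paren} {i j V} → i ≡ j → drop i s ≡ V → drop j s ≡ V
drop-cong refl eq = eq

open≢close : ∀ {a b} {U V : List Paren} → op a ∷ U ≡ cl b ∷ V → ⊥
open≢close ()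

balanced-before-close : ∀ {M Z b V} → Balanced M → M ++ Z ≡ cl b ∷ V → M ≡ []
balanced-before-close bal-nil              _  = refl
balanced-before-close (bal-cons a s t _ _) ()

adjacent : ∀ {i a} → i < a + 1 → a < i + 2 → a ≡ i ⊎ a ≡ i + 1
adjacent {i} {a} h₁ h₂ with m≤n⇒m<n∨m≡n (s≤s⁻¹ (subst (i <_) (+-comm a 1) h₁))
... | inj₂ i≡a = inj₁ (sym i≡a)
... | inj₁ i<a = inj₂ (≤-antisym (s≤s⁻¹ (subst (suc a ≤_) (+-suc i 1) h₂)) (subst (_≤ a) (+-comm 1 i) i<a))

just-after : ∀ {i a} → i < a → a < i + 2 → a ≡ i + 1
just-after {i} {a} h₁ h₂ = ≤-antisym (s≤s⁻¹ (subst (suc a ≤_) (+-suc i 1) h₂)) (subst (_≤ a) (+-comm 1 i) h₁)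

private
  +1+0≡suc : ∀ a → a + 1 + 0 ≡ suc a
  +1+0≡suc = solve-∀

  +2≡suc+1 : ∀ a → a + 2 ≡ suc (a + 1)
  +2≡suc+1 = solve-∀

  +1+0+1≡+2 : ∀ a → a + 1 + 0 + 1 ≡ a + 2
  +1+0+1≡+2 = solve-∀

  +0+0 : ∀ a → a + 0 + 0 ≡ a
  +0+0 = solve-∀

  +0+0+0 : ∀ a → a + 0 + 0 + 0 ≡ a
  +0+0+0 = solve-∀

module PairHits (a₀ a : Label) (A M B : List Paren) (bM : Balanced M) {L₁ R₁ L₂ R₂ : List Paren}
                (e₁ : A ++ op a ∷ M ++ cl a ∷ B ≡ L₁ ++ leaf a₀ ++ R₁)
                (e₂ : A ++ op a ∷ M ++ cl a ∷ B ≡ L₂ ++ leaf a₀ ++ R₂) where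

  private
    s : List Paren
    s = A ++ op a ∷ M ++ cl a ∷ B

    at-A : drop (length A) s ≡ op a ∷ M ++ cl a ∷ B
    at-A = drop-at s A _ refl

    at-L₁ : drop (length L₁) s ≡ op a₀ ∷ cl a₀ ∷ R₁
    at-L₁ = drop-at s L₁ _ e₁

    A≡L₁ : length L₁ < length A + 1 → length A < length L₁ + 2 → length A ≡ length L₁
    A≡L₁ h h′ with adjacent h h′
    ... | inj₁ eq = eq
    ... | inj₂ eq = ⊥-elim (open≢close (trans (sym (drop-cong eq at-A)) (drop-next s (length L₁) at-L₁)))

    M≡[] : length A ≡ length L₁ → M ≡ []
    M≡[] eq = balanced-before-close bM (proj₂ (∷-injective (trans (sym (drop-cong eq at-A)) at-L₁)))

  coincide : length L₁ < length A + 1 → length A < length L₁ + 2 →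
             length L₂ < length A + 1 + length M + 1 → length A + 1 + length M < length L₂ + 2 →
             length L₁ ≡ length L₂
  coincide h₁ h₁′ h₂ h₂′ with A≡L₁ h₁ h₁′
  ... | eq with M≡[] eq
  ... | refl with adjacent {length A} {length L₂} (s≤s⁻¹ (subst₂ _<_ (+1+0≡suc (length A)) (+2≡suc+1 (length L₂)) h₂′))
                                           (subst (length L₂ <_) (+1+0+1≡+2 (length A)) h₂)
  ...   | inj₁ L₂≡A = trans (sym eq) (sym L₂≡A)
  ...   | inj₂ L₂≡A+1 =
    ⊥-elim (open≢close (trans (sym (drop-at s L₂ _ e₂)) (drop-cong (sym L₂≡A+1) (drop-next s (length A) at-A))))

module InsertHits (a₀ : Label) (A M B : List Paren) (bM : Balanced M) {L₁ R₁ L₂ R₂ : List Paren}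
                  (e₁ : A ++ M ++ B ≡ L₁ ++ leaf a₀ ++ R₁) (e₂ : A ++ M ++ B ≡ L₂ ++ leaf a₀ ++ R₂) where

  coincide : length L₁ < length A + 0 → length A < length L₁ + 2 →
             length L₂ < length A + 0 + length M + 0 → length A + 0 + length M < length L₂ + 2 →
             length L₁ ≡ length L₂
  coincide h₁ h₁′ h₂ h₂′ with just-after (subst (length L₁ <_) (+-identityʳ (length A)) h₁) h₁′
  ... | A≡L₁+1 with balanced-before-close bM (trans (sym (drop-cong A≡L₁+1 (drop-at (A ++ M ++ B) A _ refl)))
                                                    (drop-next (A ++ M ++ B) (length L₁) (drop-at _ L₁ _ e₁)))
  ... | refl = +-cancelʳ-≡ 1 (length L₁) (length L₂) (trans (sym A≡L₁+1)
                 (just-after (subst (length L₂ <_) (+0+0+0 (length A)) h₂) (subst (_< length L₂ + 2) (+0+0 (length A)) h₂′)))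

-- A leaf hit by one end of an edit is also the one hit by the other end, since the balanced string between
-- the two ends cannot start with a closing parenthesis.
leaf-hits-coincide : ∀ a₀ {X Y X′ Y′} (e : PairEdit X Y X′ Y′) A M B → Balanced M → ∀ {L₁ R₁ L₂ R₂} →
  A ++ X ++ M ++ Y ++ B ≡ L₁ ++ leaf a₀ ++ R₁ → A ++ X ++ M ++ Y ++ B ≡ L₂ ++ leaf a₀ ++ R₂ →
  length L₁ < length A + length X → length A < length L₁ + 2 →
  length L₂ < length A + length X + length M + length Y → length A + length X + length M < length L₂ + 2 →
  length L₁ ≡ length L₂
leaf-hits-coincide a₀ (relabel a b) A M B bM e₁ e₂ = PairHits.coincide a₀ a A M B bM e₁ e₂
leaf-hits-coincide a₀ (delete a)    A M B bM e₁ e₂ = PairHits.coincide a₀ a A M B bM e₁ e₂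
leaf-hits-coincide a₀ (insert a)    A M B bM e₁ e₂ = InsertHits.coincide a₀ A M B bM e₁ e₂

module _ (a₀ : Label) (leaf-bal : Balanced (leaf a₀)) (leaf-nonempty : 0 < 2) where

  open Tracking (leaf a₀) leaf-bal leaf-nonempty

  hits-coincide : ∀ {s t} (st : PStep s t) (o o′ : Occurrence s) → Hit₁ st (at o) → Hit₂ st (at o′) → at o ≡ at o′
  hits-coincide (edit e A M B bM) (occurrence L₁ R₁ e₁) (occurrence L₂ R₂ e₂) (h₁ , h₁′) (h₂ , h₂′) =
    leaf-hits-coincide a₀ e A M B bM e₁ e₂ h₁ h₁′ h₂ h₂′

  leaf-loss≤1 : LossBound 1
  leaf-loss≤1 st os sp = survivors-length₁ st (Hit st) (All.tabulate (λ _ h → h)) (AllPairs.map (λ {o} {o′} → exclusive {o} {o′}) sp)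
    where
    exclusive : ∀ {o o′} → at o + 2 ≤ at o′ → Hit st (at o) → ¬ Hit st (at o′)
    exclusive {o} {o′} gap (inj₁ h) (inj₁ h′) = Hit₁-unique st {at o} {at o′} gap h h′
    exclusive {o} {o′} gap (inj₂ h) (inj₂ h′) = Hit₂-unique st {at o} {at o′} gap h h′
    exclusive {o} {o′} gap (inj₁ h) (inj₂ h′) = m+1+n≰m (at o) (subst (at o + 2 ≤_) (sym (hits-coincide st o o′ h h′)) gap)
    exclusive {o} {o′} gap (inj₂ h) (inj₁ h′) = m+1+n≰m (at o) (subst (at o + 2 ≤_) (hits-coincide st o′ o h′ h) gap)

-- Powers of Q

module Powers (Q : List Paren) (Q-nonempty : 0 < length Q) where

  pow-length : ∀ n → length (pow Q n) ≡ n * length Q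
  pow-length zero    = refl
  pow-length (suc n) = trans (length-++ Q) (cong (length Q +_) (pow-length n))

  pow-++ : ∀ m n → pow Q m ++ pow Q n ≡ pow Q (m + n)
  pow-++ zero    n = refl
  pow-++ (suc m) n = trans (++-assoc Q (pow Q m) (pow Q n)) (cong (Q ++_) (pow-++ m n))

  pow-balanced : Balanced Q → ∀ n → Balanced (pow Q n)
  pow-balanced bQ zero    = bal-nil
  pow-balanced bQ (suc n) = balanced-++ bQ (pow-balanced bQ n)

  commute-pow : ∀ {U} → U ++ Q ≡ Q ++ U → ∀ n → U ++ pow Q n ≡ pow Q n ++ U
  commute-pow {U} h zero    = ++-identityʳ U
  commute-pow {U} h (suc n) = begin
    U ++ Q ++ pow Q n      ≡⟨ sym (++-assoc U Q (pow Q n)) ⟩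
    (U ++ Q) ++ pow Q n    ≡⟨ cong (_++ pow Q n) h ⟩
    (Q ++ U) ++ pow Q n    ≡⟨ ++-assoc Q U (pow Q n) ⟩
    Q ++ U ++ pow Q n      ≡⟨ cong (Q ++_) (commute-pow h n) ⟩
    Q ++ pow Q n ++ U      ≡⟨ sym (++-assoc Q (pow Q n) U) ⟩
    (Q ++ pow Q n) ++ U    ∎
    where open ≡-Reasoning

  pow-zero-infix : ∀ U V → pow Q zero ≡ U ++ Q ++ V → ⊥
  pow-zero-infix U V eq with ++-conicalˡ Q V (++-conicalʳ U (Q ++ V) (sym eq))
  ... | Q≡[] = <-irrefl (sym (cong length Q≡[])) Q-nonempty

  private
    longer-power : ∀ n U V → pow Q (suc (suc n)) ≡ U ++ Q ++ V →
                   (∀ U V → pow Q (suc n) ≡ U ++ Q ++ V → U ++ Q ≡ Q ++ U) → U ++ Q ≡ Q ++ U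
    longer-power n U V eq ih with length Q ≤? length U
    ... | yes h with ++-split-≤ Q (pow Q (suc n)) U (Q ++ V) eq h
    ...   | U₁ , refl , e = begin
      (Q ++ U₁) ++ Q   ≡⟨ ++-assoc Q U₁ Q ⟩
      Q ++ U₁ ++ Q     ≡⟨ cong (Q ++_) (ih U₁ V e) ⟩
      Q ++ Q ++ U₁     ∎
      where open ≡-Reasoning
    longer-power n U V eq ih | no h with ++-split-≤ U (Q ++ V) Q (pow Q (suc n)) (sym eq) (<⇒≤ (≰⇒> h))
    ... | W , Q≡UW , e = begin
      U ++ Q          ≡⟨ cong (U ++_) Q≡WU ⟩
      U ++ W ++ U     ≡⟨ sym (++-assoc U W U) ⟩
      (U ++ W) ++ U   ≡⟨ cong (_++ U) (sym Q≡UW) ⟩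
      Q ++ U          ∎
      where
      open ≡-Reasoning
      Q≡WU : Q ≡ W ++ U
      Q≡WU = proj₁ (++-cancel-length Q V (W ++ U) (W ++ pow Q n)
        (trans e (trans (cong (λ Z → W ++ Z ++ pow Q n) Q≡UW) (sym (++-assoc₃ W U W (pow Q n)))))
        (trans (cong length Q≡UW) (length-++-comm U W)))

  infix-commutes : ∀ n U V → pow Q n ≡ U ++ Q ++ V → U ++ Q ≡ Q ++ U
  infix-commutes zero U V eq = ⊥-elim (pow-zero-infix U V eq)
  infix-commutes (suc zero) U V eq = subst (λ U → U ++ Q ≡ Q ++ U) (sym U≡[]) (sym (++-identityʳ Q))
    where
    lengths : length U + length V + length Q ≡ 0 + length Q
    lengths = begin
      length U + length V + length Q     ≡⟨ swap (length U) (length V) (length Q) ⟩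
      length U + (length Q + length V)   ≡⟨ cong (length U +_) (sym (length-++ Q)) ⟩
      length U + length (Q ++ V)         ≡⟨ sym (length-++ U) ⟩
      length (U ++ Q ++ V)               ≡⟨ cong length (sym eq) ⟩
      length (Q ++ [])                   ≡⟨ cong length (++-identityʳ Q) ⟩
      length Q                           ∎
      where
      open ≡-Reasoning
      swap : ∀ u v q → u + v + q ≡ u + (q + v)
      swap = solve-∀
    U≡[] : U ≡ []
    U≡[] = length≡0⇒[] U (m+n≡0⇒m≡0 (length U) (+-cancelʳ-≡ (length Q) (length U + length V) 0 lengths))
  infix-commutes (suc (suc n)) U V eq = longer-power n U V eq (infix-commutes (suc n))


  replace-copy : ∀ n U V → pow Q n ≡ U ++ Q ++ V → ∀ r → U ++ pow Q r ++ V ≡ pow Q (r + pred n)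
  replace-copy zero U V e r = ⊥-elim (pow-zero-infix U V e)
  replace-copy (suc n) U V e r = begin
    U ++ pow Q r ++ V     ≡⟨ sym (++-assoc U (pow Q r) V) ⟩
    (U ++ pow Q r) ++ V   ≡⟨ cong (_++ V) (commute-pow UQ≡QU r) ⟩
    (pow Q r ++ U) ++ V   ≡⟨ ++-assoc (pow Q r) U V ⟩
    pow Q r ++ U ++ V     ≡⟨ cong (pow Q r ++_) UV≡pow ⟩
    pow Q r ++ pow Q n    ≡⟨ pow-++ r n ⟩
    pow Q (r + n)         ∎
    where
    open ≡-Reasoning
    UQ≡QU : U ++ Q ≡ Q ++ U
    UQ≡QU = infix-commutes (suc n) U V e
    UV≡pow : U ++ V ≡ pow Q n
    UV≡pow = ++-cancelˡ Q (U ++ V) (pow Q n) (begin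
      Q ++ U ++ V     ≡⟨ sym (++-assoc Q U V) ⟩
      (Q ++ U) ++ V   ≡⟨ cong (_++ V) (sym UQ≡QU) ⟩
      (U ++ Q) ++ V   ≡⟨ ++-assoc U Q V ⟩
      U ++ Q ++ V     ≡⟨ sym e ⟩
      Q ++ pow Q n    ∎)


module Pumping (Q : List Paren) (Q-balanced : Balanced Q) (Q-nonempty : 0 < length Q) where

  open Tracking Q Q-balanced Q-nonempty
  open Powers Q Q-nonempty
  open Occurrence

  pump : ∀ {X Y n} (o : Occurrence (X ++ pow Q n ++ Y)) → length X ≤ at o → at o + ∣Q∣ ≤ length X + n * ∣Q∣ →
         ∀ r → before o ++ pow Q r ++ after o ≡ X ++ pow Q (r + pred n) ++ Y
  pump {X} {Y} {n} (occurrence L R eq) h₁ h₂ r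
    with infix-within L Q R X (pow Q n) Y (sym eq) h₁ (subst (λ l → length L + ∣Q∣ ≤ length X + l) (sym (pow-length n)) h₂)
  ... | U , V , refl , e , refl = begin
    (X ++ U) ++ pow Q r ++ V ++ Y   ≡⟨ ++-assoc₃ X U (pow Q r) (V ++ Y) ⟩
    X ++ (U ++ pow Q r) ++ V ++ Y   ≡⟨ cong (X ++_) (sym (++-assoc (U ++ pow Q r) V Y)) ⟩
    X ++ ((U ++ pow Q r) ++ V) ++ Y ≡⟨ cong (λ Z → X ++ Z ++ Y) (trans (++-assoc U (pow Q r) V) (replace-copy n U V e r)) ⟩
    X ++ pow Q (r + pred n) ++ Y    ∎
    where open ≡-Reasoning

  copies : ∀ U n V {s} → s ≡ U ++ pow Q n ++ V → List (Occurrence s)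
  copies U zero    V eq = []
  copies U (suc n) V eq = occurrence U (pow Q n ++ V) (trans eq (cong (U ++_) (++-assoc Q (pow Q n) V)))
                        ∷ copies (U ++ Q) n V (trans eq (sym (++-assoc₃ U Q (pow Q n) V)))

  copies-length : ∀ U n V {s} (eq : s ≡ U ++ pow Q n ++ V) → length (copies U n V eq) ≡ n
  copies-length U zero    V eq = refl
  copies-length U (suc n) V eq = cong suc (copies-length (U ++ Q) n V _)

  copies-within : ∀ U n V {s} (eq : s ≡ U ++ pow Q n ++ V) →
                  All (λ o → length U ≤ at o × at o + ∣Q∣ ≤ length U + n * ∣Q∣) (copies U n V eq)
  copies-within U zero    V eq = []
  copies-within U (suc n) V eq =
    (≤-refl , +-monoʳ-≤ (length U) (m≤m+n ∣Q∣ (n * ∣Q∣))) ∷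
    All.map (λ (l , u) → ≤-trans (m≤m+n (length U) ∣Q∣) (≤-trans (≤-reflexive (sym (length-++ U))) l) ,
                         ≤-trans u (≤-reflexive (trans (cong (_+ n * ∣Q∣) (length-++ U)) (+-assoc (length U) ∣Q∣ _))))
            (copies-within (U ++ Q) n V _)

  copies-spaced : ∀ U n V {s} (eq : s ≡ U ++ pow Q n ++ V) → Spaced (copies U n V eq)
  copies-spaced U zero    V eq = []
  copies-spaced U (suc n) V eq =
    All.map (λ (l , _) → ≤-trans (≤-reflexive (sym (length-++ U))) l) (copies-within (U ++ Q) n V _)
    ∷ copies-spaced (U ++ Q) n V _

  split-block : ∀ X lo w hi Y → X ++ pow Q (lo + w + hi) ++ Y ≡ (X ++ pow Q lo) ++ pow Q w ++ pow Q hi ++ Y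
  split-block X lo w hi Y = begin
    X ++ pow Q (lo + w + hi) ++ Y                ≡⟨ cong (λ Z → X ++ Z ++ Y) (sym three-powers) ⟩
    X ++ (pow Q lo ++ pow Q w ++ pow Q hi) ++ Y  ≡⟨ regroup X (pow Q lo) (pow Q w) (pow Q hi) Y ⟩
    (X ++ pow Q lo) ++ pow Q w ++ pow Q hi ++ Y  ∎
    where
    open ≡-Reasoning
    three-powers : pow Q lo ++ pow Q w ++ pow Q hi ≡ pow Q (lo + w + hi)
    three-powers = trans (cong (pow Q lo ++_) (pow-++ w hi)) (trans (pow-++ lo (w + hi)) (cong (pow Q) (sym (+-assoc lo w hi))))
    regroup : ∀ (A X Y Z B : List Paren) → A ++ (X ++ Y ++ Z) ++ B ≡ (A ++ X) ++ Y ++ Z ++ B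
    regroup A X Y Z B = solve (++-monoid Paren)

  surviving-copy : ∀ {b m lo w hi X Y t} → LossBound b → b * m < w → PSteps m (X ++ pow Q (lo + w + hi) ++ Y) t →
    ∃[ o ] (length X + lo * ∣Q∣ ≤ at o × at o + ∣Q∣ ≤ length X + lo * ∣Q∣ + w * ∣Q∣) × Tracked m t o
  surviving-copy {lo = lo} {w} {hi} {X} {Y} lb wide sts =
    Any.lookup survivor , All.lookupWith (λ bounds tr → shift bounds , tr) (copies-within _ w _ window) survivor
    where
    window : X ++ pow Q (lo + w + hi) ++ Y ≡ (X ++ pow Q lo) ++ pow Q w ++ pow Q hi ++ Y
    window = split-block X lo w hi Y
    survivor : Any (Tracked _ _) (copies (X ++ pow Q lo) w (pow Q hi ++ Y) window)
    survivor = tracked lb sts _ (copies-spaced _ w _ window) (<-≤-trans wide (≤-reflexive (sym (copies-length _ w _ window))))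
    prefix-length : length (X ++ pow Q lo) ≡ length X + lo * ∣Q∣
    prefix-length = trans (length-++ X) (cong (length X +_) (pow-length lo))
    shift : ∀ {i} → length (X ++ pow Q lo) ≤ i × i + ∣Q∣ ≤ length (X ++ pow Q lo) + w * ∣Q∣ →
            length X + lo * ∣Q∣ ≤ i × i + ∣Q∣ ≤ length X + lo * ∣Q∣ + w * ∣Q∣
    shift {i} (l , u) = subst (_≤ i) prefix-length l , subst (λ n → i + ∣Q∣ ≤ n + w * ∣Q∣) prefix-length u

  private
    lower-margin : ∀ {a g p p′ m k L} → g ≤ a + 2 * k → m ≤ k → 4 * k ≤ L → a + L ≤ p → p ≤ p′ + 2 * m → g ≤ p′
    lower-margin {a} {g} {p} {p′} {m} {k} {L} hg hm hL hp hd = +-cancelʳ-≤ (2 * m) g p′ (begin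
      g + 2 * m           ≤⟨ +-mono-≤ hg (*-monoʳ-≤ 2 hm) ⟩
      a + 2 * k + 2 * k   ≡⟨ rearrange a k ⟩
      a + 4 * k           ≤⟨ +-monoʳ-≤ a hL ⟩
      a + L               ≤⟨ hp ⟩
      p                   ≤⟨ hd ⟩
      p′ + 2 * m          ∎)
      where
      open ≤-Reasoning
      rearrange : ∀ a k → a + 2 * k + 2 * k ≡ a + 4 * k
      rearrange = solve-∀

    spread : ∀ lo w hi c → (lo + w + hi) * c ≡ lo * c + w * c + hi * c
    spread = solve-∀

    upper-margin : ∀ {a g p p′ m k lo w hi} → a ≤ g + 2 * k → m ≤ k → 4 * k ≤ hi * ∣Q∣ →
                   p + ∣Q∣ ≤ a + lo * ∣Q∣ + w * ∣Q∣ → p′ ≤ p + 2 * m → p′ + ∣Q∣ ≤ g + (lo + w + hi) * ∣Q∣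
    upper-margin {a} {g} {p} {p′} {m} {k} {lo} {w} {hi} ha hm hH hp hd = begin
      p′ + ∣Q∣                                    ≤⟨ +-monoˡ-≤ ∣Q∣ hd ⟩
      p + 2 * m + ∣Q∣                             ≡⟨ swap p (2 * m) ∣Q∣ ⟩
      p + ∣Q∣ + 2 * m                             ≤⟨ +-mono-≤ hp (*-monoʳ-≤ 2 hm) ⟩
      a + lo * ∣Q∣ + w * ∣Q∣ + 2 * k              ≤⟨ +-monoˡ-≤ (2 * k) (+-monoˡ-≤ _ (+-monoˡ-≤ (lo * ∣Q∣) ha)) ⟩
      g + 2 * k + lo * ∣Q∣ + w * ∣Q∣ + 2 * k      ≡⟨ rearrange g k (lo * ∣Q∣) (w * ∣Q∣) ⟩
      g + (lo * ∣Q∣ + w * ∣Q∣ + 4 * k)            ≤⟨ +-monoʳ-≤ g (+-monoʳ-≤ (lo * ∣Q∣ + w * ∣Q∣) hH) ⟩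
      g + (lo * ∣Q∣ + w * ∣Q∣ + hi * ∣Q∣)         ≡⟨ cong (g +_) (sym (spread lo w hi ∣Q∣)) ⟩
      g + (lo + w + hi) * ∣Q∣                     ∎
      where
      open ≤-Reasoning
      swap : ∀ p d c → p + d + c ≡ p + c + d
      swap = solve-∀
      rearrange : ∀ g k L W → g + 2 * k + L + W + 2 * k ≡ g + (L + W + 4 * k)
      rearrange = solve-∀

    block-end : ∀ {a p lo w hi} → p + ∣Q∣ ≤ a + lo * ∣Q∣ + w * ∣Q∣ → p + ∣Q∣ ≤ a + (lo + w + hi) * ∣Q∣
    block-end {a} {p} {lo} {w} {hi} hp = ≤-trans hp (subst₂ _≤_ (sym (+-assoc a _ _)) (cong (a +_) (sym (spread lo w hi ∣Q∣)))
                                                           (+-monoʳ-≤ a (m≤m+n _ (hi * ∣Q∣))))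

  -- The surviving copy lies lo copies deep in the block of F; the margins lo and hi absorb its drift of at
  -- most 2 m and the offset of at most 2 k between the blocks, so its image lies in the block of G.
  pump-steps : ∀ {b k m lo w hi AF BF AG BG} → LossBound b → m ≤ k → b * k < w → 4 * k ≤ lo * ∣Q∣ → 4 * k ≤ hi * ∣Q∣ →
    length AF ≤ length AG + 2 * k → length AG ≤ length AF + 2 * k →
    PSteps m (AF ++ pow Q (lo + w + hi) ++ BF) (AG ++ pow Q (lo + w + hi) ++ BG) →
    ∀ r → PSteps m (AF ++ pow Q (r + pred (lo + w + hi)) ++ BF) (AG ++ pow Q (r + pred (lo + w + hi)) ++ BG)
  pump-steps {b} {k} {m} {lo} {w} {hi} {AF} {BF} {AG} {BG} lb m≤k wide hlo hhi hF hG sts r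
    with surviving-copy {lo = lo} {w} {hi} {AF} {BF} lb (≤-<-trans (*-monoʳ-≤ b m≤k) wide) sts
  ... | o , (start , finish) , tr =
    subst₂ (PSteps m)
      (pump {AF} {BF} {lo + w + hi} o (≤-trans (m≤m+n (length AF) (lo * ∣Q∣)) start) (block-end {lo = lo} {w} {hi} finish) r)
      (pump {AG} {BG} {lo + w + hi} (Tracked.image tr) (lower-margin hG m≤k hlo start (Tracked.drift-≥ tr))
                                         (upper-margin {g = length AG} {lo = lo} {w} {hi} hF m≤k hhi finish (Tracked.drift-≤ tr)) r)
           (Tracked.transfer tr (pow Q r) (pow-balanced Q-balanced r))

-- Changing the exponent

balanced-length≥2 : ∀ {x M} → Balanced (x ∷ M) → 2 ≤ length (x ∷ M)
balanced-length≥2 (bal-cons a s t _ _) = s≤s (≤-trans (s≤s z≤n) (≤-trans (m≤n+m _ (length s)) (≤-reflexive (sym (length-++ s)))))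

balanced-shape : ∀ {Q} → Balanced Q → 0 < length Q → (∃[ a ] Q ≡ leaf a) ⊎ 4 ≤ length Q
balanced-shape (bal-cons a []      []      _  _)  _ = inj₁ (a , refl)
balanced-shape (bal-cons a []      (x ∷ t) _  bt) _ = inj₂ (s≤s (s≤s (balanced-length≥2 bt)))
balanced-shape (bal-cons a (x ∷ s) t       bs _)  _ =
  inj₂ (s≤s (≤-trans (+-mono-≤ (balanced-length≥2 bs) (s≤s z≤n)) (≤-reflexive (sym (length-++ (x ∷ s))))))

loss-budget : ∀ {Q} (bQ : Balanced Q) (Qn : 0 < length Q) →
              ∃[ b ] Tracking.LossBound Q bQ Qn b × (b ≡ 1 × length Q ≡ 2 ⊎ b ≡ 2 × 4 ≤ length Q)
loss-budget bQ Qn with balanced-shape bQ Qn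
... | inj₁ (a , refl) = 1 , leaf-loss≤1 a bQ Qn , inj₁ (refl , refl)
... | inj₂ c≥4        = 2 , Tracking.loss≤2 _ bQ Qn , inj₂ (refl , c≥4)

module Resizing {Q : List Paren} (bQ : Balanced Q) (Qn : 0 < length Q) {k m : ℕ} (k≥1 : 1 ≤ k) (m≤k : m ≤ k)
                (AF BF AG BG : List Paren) (hF : length AF ≤ length AG + 2 * k) (hG : length AG ≤ length AF + 2 * k) where

  open Pumping Q bQ Qn using (pump-steps)

  Edits : ℕ → Set
  Edits E = PSteps m (AF ++ pow Q E ++ BF) (AG ++ pow Q E ++ BG)

  private
    k<2k : k < 2 * k
    k<2k = subst₂ _<_ (+-identityʳ k) (cong (k +_) (sym (+-identityʳ k))) (+-monoʳ-< k k≥1)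

    2k<4k : 2 * k < 4 * k
    2k<4k = subst (2 * k <_) (double k) (*-monoʳ-< 2 k<2k)
      where
      double : ∀ k → 2 * (2 * k) ≡ 4 * k
      double = solve-∀

    leaf-window-sum : ∀ k d → 2 * k + (2 * k + d) + 2 * k ≡ 6 * k + d
    leaf-window-sum = solve-∀

    long-window-sum : ∀ k d → k + (4 * k + d) + k ≡ 6 * k + d
    long-window-sum = solve-∀

    doubled : ∀ k → 2 * k * 2 ≡ 4 * k
    doubled = solve-∀

    through-window : ∀ {b lo w hi E} → Tracking.LossBound Q bQ Qn b → b * k < w →
                     4 * k ≤ lo * length Q → 4 * k ≤ hi * length Q → lo + w + hi ≡ E →
                     Edits E → ∀ r → Edits (r + pred E)
    through-window {lo = lo} {w} {hi} lb wide hlo hhi refl sts =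
      pump-steps {lo = lo} {w} {hi} {AF} {BF} {AG} {BG} lb m≤k wide hlo hhi hF hG sts

  -- Margins of 4 k symbols take 4 k of the 6 k copies of a leaf, leaving too few for a loss of two copies per
  -- edit; hence leaves use the budget of one loss per edit, longer patterns margins of only k copies.
  resize-by-one : ∀ {E} → 6 * k ≤ E → Edits E → ∀ r → Edits (r + pred E)
  resize-by-one {E} hE with E ∸ 6 * k | m+[n∸m]≡n hE | loss-budget bQ Qn
  ... | d | refl | b , lb , inj₁ (refl , c≡2) =
    through-window {lo = 2 * k} {w = 2 * k + d} {hi = 2 * k} lb
      (<-≤-trans (subst (_< 2 * k) (sym (*-identityˡ k)) k<2k) (m≤m+n (2 * k) d)) margin margin (leaf-window-sum k d)
    where
    margin : 4 * k ≤ 2 * k * length Q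
    margin = ≤-reflexive (trans (sym (doubled k)) (cong (2 * k *_) (sym c≡2)))
  ... | d | refl | b , lb , inj₂ (refl , c≥4) =
    through-window {lo = k} {w = 4 * k + d} {hi = k} lb (<-≤-trans 2k<4k (m≤m+n (4 * k) d)) margin margin (long-window-sum k d)
    where
    margin : 4 * k ≤ k * length Q
    margin = ≤-trans (≤-reflexive (*-comm 4 k)) (*-monoʳ-≤ k c≥4)

  grow : ∀ {E} → 6 * k ≤ E → Edits E → Edits (suc E)
  grow {zero} h with ≤-trans (*-monoʳ-≤ 6 k≥1) h
  ... | ()
  grow {suc E} h sts = resize-by-one h sts 2

  shrink : ∀ {E} → 6 * k ≤ E → Edits E → Edits (pred E)
  shrink h sts = resize-by-one h sts 0

  grow-by : ∀ {E} → 6 * k ≤ E → ∀ d → Edits E → Edits (d + E)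
  grow-by h zero    sts = sts
  grow-by h (suc d) sts = grow (≤-trans h (m≤n+m _ d)) (grow-by h d sts)

  shrink-by : ∀ {E} → 6 * k ≤ E → ∀ d → Edits (d + E) → Edits E
  shrink-by h zero    sts = sts
  shrink-by h (suc d) sts = shrink-by h d (shrink (≤-trans h (m≤n+m _ (suc d))) sts)

  resize : ∀ {E E′} → 6 * k ≤ E → 6 * k ≤ E′ → Edits E → Edits E′
  resize {E} {E′} h h′ sts with ≤-total E E′
  ... | inj₁ E≤E′ = subst Edits (m∸n+n≡m E≤E′) (grow-by h (E′ ∸ E) sts)
  ... | inj₂ E′≤E = shrink-by h′ (E ∸ E′) (subst Edits (sym (m∸n+n≡m E′≤E)) sts)

  Steps-resize : ∀ {E E′ F G F′ G′} → 6 * k ≤ E → 6 * k ≤ E′ →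
                 P F ≡ AF ++ pow Q E ++ BF → P G ≡ AG ++ pow Q E ++ BG →
                 P F′ ≡ AF ++ pow Q E′ ++ BF → P G′ ≡ AG ++ pow Q E′ ++ BG → Steps m F G → Steps m F′ G′
  Steps-resize hE hE′ eF eG eF′ eG′ sts =
    PSteps⇒Steps (subst₂ (PSteps m) (sym eF′) (sym eG′) (resize hE hE′ (subst₂ (PSteps m) eF eG (P-steps sts))))

around-slice : ∀ {A : Set} (S : List A) {α β} → α ≤ β → S ≡ slice S 0 α ++ slice S α β ++ slice S β (length S)
around-slice S {α} {β} α≤β = begin
  S                                                  ≡⟨ sym (take++drop≡id α S) ⟩
  take α S ++ drop α S                               ≡⟨ cong (take α S ++_) (sym (take++drop≡id (β ∸ α) (drop α S))) ⟩
  take α S ++ slice S α β ++ drop (β ∸ α) (drop α S) ≡⟨ cong (λ Z → take α S ++ slice S α β ++ Z) (drop-drop α (β ∸ α) S) ⟩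
  take α S ++ slice S α β ++ drop (α + (β ∸ α)) S    ≡⟨ cong (λ n → take α S ++ slice S α β ++ drop n S) (m+[n∸m]≡n α≤β) ⟩
  take α S ++ slice S α β ++ drop β S                ≡⟨ cong (λ Z → take α S ++ slice S α β ++ Z) (sym to-end) ⟩
  slice S 0 α ++ slice S α β ++ slice S β (length S) ∎
  where
  open ≡-Reasoning
  to-end : slice S β (length S) ≡ drop β S
  to-end = take-all (length S ∸ β) (drop β S) (≤-reflexive (length-drop β S))

prefixes-near : ∀ {A : Set} (S T : List A) {α α′ d} → α ≤ length S → α′ ≤ length T → ∣ α - α′ ∣ ≤ d →
                length (slice S 0 α) ≤ length (slice T 0 α′) + d
prefixes-near S T {α} {α′} {d} α≤ α′≤ dist =
  subst₂ (λ x y → x ≤ y + d) (sym (length-slice S α≤)) (sym (length-slice T α′≤))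
         (≤-trans (m≤n+∣m-n∣ α α′) (+-monoʳ-≤ α′ dist))
  where
  length-slice : ∀ {A : Set} (S : List A) {α} → α ≤ length S → length (slice S 0 α) ≡ α
  length-slice S {α} h = trans (length-take α S) (m≤n⇒m⊓n≡m h)

TedLe-transfer : ∀ {k F G F′ G′} → (∀ {m} → m ≤ k → Steps m F G → Steps m F′ G′) →
                 (∀ {m} → m ≤ k → Steps m F′ G′ → Steps m F G) → ∀ r → TedLe k F G r → TedLe k F′ G′ r
TedLe-transfer {k} {F′ = F′} {G′} to from (just d) ((sts , minimal) , d≤k) = (to d≤k sts , minimal′) , d≤k
  where
  minimal′ : ∀ m → Steps m F′ G′ → d ≤ m
  minimal′ m sts′ with m ≤? k
  ... | yes m≤k = minimal m (from m≤k sts′)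
  ... | no  m≰k = ≤-trans d≤k (<⇒≤ (≰⇒> m≰k))
TedLe-transfer {k} to from nothing far m sts′ with m ≤? k
... | yes m≤k = far m (from m≤k sts′)
... | no  m≰k = ≰⇒> m≰k

lemma6p9 : (k : ℕ) → 1 ≤ k →
    (F G F' G' : Forest) (Q : List Paren) (e e' αF βF αG βG : ℕ) →
    Balanced Q → 0 < length Q → length Q ≤ 4 * k →
    6 * k ≤ e → 6 * k ≤ e' →
    αF ≤ βF → βF ≤ length (P F) → αG ≤ βG → βG ≤ length (P G) →
    slice (P F) αF βF ≡ pow Q e → slice (P G) αG βG ≡ pow Q e →
    ∣ αF - αG ∣ ≤ 2 * k →
    P F' ≡ slice (P F) 0 αF ++ (pow Q e' ++ slice (P F) βF (length (P F))) →
    P G' ≡ slice (P G) 0 αG ++ (pow Q e' ++ slice (P G) βG (length (P G))) →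
    (r : Maybe ℕ) → (TedLe k F G r → TedLe k F' G' r) × (TedLe k F' G' r → TedLe k F G r)
lemma6p9 k k≥1 F G F' G' Q e e' αF βF αG βG bQ Qn _ he he' αF≤βF βF≤ αG≤βG βG≤ sF sG dist eF' eG' r =
  TedLe-transfer to from r , TedLe-transfer from to r
  where
  XF YF XG YG : List Paren
  XF = slice (P F) 0 αF
  YF = slice (P F) βF (length (P F))
  XG = slice (P G) 0 αG
  YG = slice (P G) βG (length (P G))
  P-F : P F ≡ XF ++ pow Q e ++ YF
  P-F = trans (around-slice (P F) αF≤βF) (cong (λ Z → XF ++ Z ++ YF) sF)
  P-G : P G ≡ XG ++ pow Q e ++ YG
  P-G = trans (around-slice (P G) αG≤βG) (cong (λ Z → XG ++ Z ++ YG) sG)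
  F-near : length XF ≤ length XG + 2 * k
  F-near = prefixes-near (P F) (P G) (≤-trans αF≤βF βF≤) (≤-trans αG≤βG βG≤) dist
  G-near : length XG ≤ length XF + 2 * k
  G-near = prefixes-near (P G) (P F) (≤-trans αG≤βG βG≤) (≤-trans αF≤βF βF≤) (subst (_≤ 2 * k) (∣-∣-comm αF αG) dist)
  to : ∀ {m} → m ≤ k → Steps m F G → Steps m F' G'
  to m≤k = Resizing.Steps-resize bQ Qn k≥1 m≤k XF YF XG YG F-near G-near he he' P-F P-G eF' eG'
  from : ∀ {m} → m ≤ k → Steps m F' G' → Steps m F G
  from m≤k = Resizing.Steps-resize bQ Qn k≥1 m≤k XF YF XG YG F-near G-near he' he eF' eG' P-F P-G
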